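{- Let $(V,\mathcal{B})$ be a $(v,3,1)$-BIBD (Steiner triple system) and let $\Gamma$ be the bipartite graph with vertex set $V\sqcup\mathcal{B}$ and edges $\{x,B\}$ for $x\in B$. Then there is a set $S\subseteq V$ of at most $1+\lceil\log_{2}v\rceil$ points such that, after individualizing the elements of $S$ and applying the Weisfeiler–Leman algorithm, the final colouring of $\Gamma$ assigns pairwise distinct colours to all vertices of $\Gamma$ (i.e. $S$ completely splits $\Gamma$).
   Context: A $(v,k,\lambda)$-BIBD is a pair $(V,\mathcal{B})$ where $V$ is a finite set of $v$ points and $\mathcal{B}$ is a set (no repeated blocks) of $k$-subsets of $V$, such that every pair of distinct points lies in exactly $\lambda$ blocks; trivial cases are excluded. The (2-dimensional) Weisfeiler–Leman algorithm on a graph with vertex set $X$ and an initial colouring $c_{0}$ of $X^{2}$ (by default: $c_{0}(x,x)=$ "vertex", $c_{0}(x,y)=$ "edge"/"non-edge" for $x\ne y$) refines colours by $c_{j+1}(x,y)=\big(c_{j}(x,y),\{\!\{(c_{j}(x,z),c_{j}(z,y)):z\in X\}\!\}\big)$ until the colour partition of $X^{2}$ stabilizes; the colour of a vertex $x$ is the final colour of $(x,x)$. Individualizing a set $S$ of vertices means modifying the initial colouring so that each $(x,x)$ with $x\in S$ receives its own new colour, distinct from all other colours. $S$ completely splits the graph if the resulting final colouring gives distinct colours to any two distinct vertices. -}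

module Defs where

open import Data.Nat using (ℕ; zero; suc; _+_; _*_; _^_)
open import Data.Bool using (Bool; true; false; if_then_else_)
open import Data.Fin using (Fin; _≟_)
open import Data.Fin.Subset using (Subset; _∈_; ∣_∣)
open import Data.Fin.Subset.Properties using (_∈?_)
open import Data.Sum using (_⊎_; inj₁; inj₂)
open import Data.Sum.Properties using (≡-dec)
open import Data.Product using (Σ; _×_; _,_; ∃-syntax)
open import Relation.Nullary using (¬_; does; yes; no)
open import Relation.Binary.Definitions using (DecidableEquality)
open import Relation.Binary.PropositionalEquality using (_≡_; _≢_)
open import Function.Bundles using (_↔_; Inverse)

IsSTS : (v b : ℕ) → (Fin b → Subset v) → Set
IsSTS v b B =
  (∀ i → ∣ B i ∣ ≡ 3)
  -- no repeated blocks (𝓑 is a set)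
  × (∀ i j → B i ≡ B j → i ≡ j)
  × (∀ x y → x ≢ y →
       Σ (Fin b) λ i → (x ∈ B i × y ∈ B i) ×
         (∀ j → x ∈ B j → y ∈ B j → j ≡ i))

-- 2-dimensional Weisfeiler–Leman on a graph with vertex type X
-- (decidable equality, Boolean adjacency), with individualized set ind.

data Colour (X : Set) : Set where
  vertex  : Colour X
  edge    : Colour X
  nonedge : Colour X
  indiv   : X → Colour X

module WL {X : Set} (_≟X_ : DecidableEquality X)
          (adj : X → X → Bool) (ind : X → Bool) where

  c₀ : X → X → Colour X
  c₀ x y with x ≟X y
  ... | yes _ = if ind x then indiv x else vertex
  ... | no  _ = if adj x y then edge else nonedge

  -- Same j x y x' y' : c_j(x,y) = c_j(x',y').
  -- Equality of the multisets {{(c_j(x,z), c_j(z,y)) : z}} and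
  -- {{(c_j(x',z'), c_j(z',y')) : z'}} is expressed as the existence of a
  -- bijection σ of X matching them colour-wise.
  Same : ℕ → X → X → X → X → Set
  Same zero    x y x' y' = c₀ x y ≡ c₀ x' y'
  Same (suc j) x y x' y' =
    Same j x y x' y' ×
    Σ (X ↔ X) λ σ → ∀ z →
      Same j x z x' (Inverse.to σ z) × Same j z y (Inverse.to σ z) y'

Γvertex : ℕ → ℕ → Set
Γvertex v b = Fin v ⊎ Fin b

Γadj : {v b : ℕ} → (Fin b → Subset v) → Γvertex v b → Γvertex v b → Bool
Γadj B (inj₁ x) (inj₂ i) = does (x ∈? B i)
Γadj B (inj₂ i) (inj₁ x) = does (x ∈? B i)
Γadj B _        _        = false

Γind : {v b : ℕ} → Subset v → Γvertex v b → Bool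
Γind S (inj₁ x) = does (x ∈? S)
Γind S (inj₂ _) = false

Γ≟ : {v b : ℕ} → DecidableEquality (Γvertex v b)
Γ≟ = ≡-dec _≟_ _≟_

-- The partition of X² stabilizes after at most |X|² rounds, and once
-- stable it never changes, so round |X|² = (v+b)² is the final colouring.
FinalSame : {v b : ℕ} → (Fin b → Subset v) → Subset v →
            Γvertex v b → Γvertex v b → Γvertex v b → Γvertex v b → Set
FinalSame {v} {b} B S = WL.Same Γ≟ (Γadj B) (Γind S) ((v + b) ^ 2)

CompletelySplits : {v b : ℕ} → (Fin b → Subset v) → Subset v → Set
CompletelySplits {v} {b} B S =
  ∀ (p q : Γvertex v b) → FinalSame B S p p q q → p ≡ q

-- For distinct points s, t let third s t be the remaining point of their block.
-- Call a set of points closed if it contains the third point of any two of its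
-- points; closing a set C round by round reaches a closed set, its closure,
-- after at most v rounds (each unfinished round adds a point).
--
-- Weisfeiler–Leman side: a block through two points distinguished at round d is
-- distinguished at round d + 2, and then their third point at round d + 4.  So
-- if the closure of S is everything, all points are distinguished by round 4v,
-- all blocks by round 4v + 2, and 4v + 2 ≤ (v + b)², the final round.
--
-- Counting side: if W ⊆ W′ are closed and p ∈ W′ ∖ W, then W, p and the points
-- third p w (w ∈ W) are distinct points of W′, so |W′| + 1 ≥ 2 (|W| + 1).  Hence
-- starting from one point and greedily adjoining points outside the closure
-- produces a generating set after at most ⌈log₂ v⌉ additions.

module Submission where

open import Defs
open import Data.Nat using (ℕ; _+_; _≤_; _<_)
open import Data.Nat.Logarithm using (⌈log₂_⌉)
open import Data.Fin using (Fin)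
open import Data.Fin.Subset using (Subset; ∣_∣)
open import Data.Product using (Σ; _×_)

open import Data.Nat using (zero; suc; z≤n; s≤s; _*_; _^_; _∸_)
import Data.Nat.Properties as ℕ
open import Data.Nat.Logarithm using (⌈log₂⌉-mono-≤; ⌈log₂2^n⌉≡n)
open import Data.Fin using (zero; suc; _≟_)
open import Data.Fin.Properties using (any?; all?; ¬∀⟶∃¬; suc-injective; toℕ<n)
open import Data.Fin.Subset using (_∈_; _∉_; _⊆_; _⊂_; _∪_; ⁅_⁆; inside; outside)
open import Data.Fin.Subset.Properties
  using (_∈?_; _⊂?_; ∈⊤; ⊆⊤; ∣⊤∣≡n; ∣⁅x⁆∣≡1; x∈⁅x⁆; x∈⁅y⁆⇒x≡y; p⊆p∪q; q⊆p∪q; x∈p∪q⁻;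
         p⊆q⇒∣p∣≤∣q∣; p⊂q⇒∣p∣<∣q∣; ∣p∣≤n; ∣p∣≡n⇒p≡⊤)
open import Data.Bool using (Bool; true; false)
open import Data.Vec using (_∷_; []; here; there; tabulate)
open import Data.Vec.Properties using (lookup∘tabulate; lookup⇒[]=; []=⇒lookup)
open import Data.List using (List; _∷_; []; _++_; map; length)
open import Data.List.Properties using (length-++; length-map)
open import Data.List.Membership.Propositional using () renaming (_∈_ to _∈ₗ_)
open import Data.List.Membership.Propositional.Properties using (∈-map⁺; ∈-map⁻; ∈-++⁺ˡ; ∈-++⁺ʳ; ∈-++⁻; ∈-∃++)
open import Data.List.Relation.Binary.Subset.Propositional using () renaming (_⊆_ to _⊆ₗ_)
open import Data.List.Relation.Binary.Disjoint.Propositional using (Disjoint)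
open import Data.List.Relation.Unary.Any using (here; there)
import Data.List.Relation.Unary.All as All
open import Data.List.Relation.Unary.All using ([]; _∷_)
open import Data.List.Relation.Unary.AllPairs using ([]; _∷_)
open import Data.List.Relation.Unary.All.Properties using () renaming (map⁺ to All-map⁺)
open import Data.List.Relation.Unary.Unique.Propositional using (Unique)
open import Data.List.Relation.Unary.Unique.Propositional.Properties
  using (Unique[x∷xs]⇒x∉xs; ++⁺) renaming (map⁺ to Unique-map⁺)
open import Data.Product using (_,_; proj₁; proj₂; ∃; ∃₂)
open import Data.Sum using (_⊎_; inj₁; inj₂; [_,_]′)
import Data.Sum as Sum
open import Data.Empty using (⊥-elim)
open import Function using (_∘_)
open import Function.Bundles using (Inverse)
open import Function.Properties.Inverse using (↔-sym)
open import Relation.Binary.Definitions using (DecidableEquality)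
open import Relation.Nullary using (¬_; Dec; yes; no; does; contradiction; ¬?; _×-dec_)
open import Relation.Nullary.Decidable using (dec-true)
open import Relation.Unary using (Decidable)
open import Relation.Binary.PropositionalEquality
  using (_≡_; _≢_; refl; sym; trans; cong; subst; ≢-sym; module ≡-Reasoning)

-- The elements of a subset, listed in increasing order and without repetition;
-- they translate cardinalities ∣ p ∣ into lengths of lists.
elements : ∀ {n} → Subset n → List (Fin n)
elements []            = []
elements (inside  ∷ p) = zero ∷ map suc (elements p)
elements (outside ∷ p) = map suc (elements p)

elements-length : ∀ {n} (p : Subset n) → length (elements p) ≡ ∣ p ∣
elements-length []            = refl
elements-length (inside  ∷ p) = cong suc (trans (length-map suc (elements p)) (elements-length p))
elements-length (outside ∷ p) = trans (length-map suc (elements p)) (elements-length p)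

elements-unique : ∀ {n} (p : Subset n) → Unique (elements p)
elements-unique []            = []
elements-unique (inside  ∷ p) =
  All-map⁺ (All.universal (λ _ ()) (elements p)) ∷ Unique-map⁺ suc-injective (elements-unique p)
elements-unique (outside ∷ p) = Unique-map⁺ suc-injective (elements-unique p)

∈-elements⁺ : ∀ {n} (p : Subset n) {x} → x ∈ p → x ∈ₗ elements p
∈-elements⁺ (inside  ∷ p) here       = here refl
∈-elements⁺ (inside  ∷ p) (there x∈) = there (∈-map⁺ suc (∈-elements⁺ p x∈))
∈-elements⁺ (outside ∷ p) (there x∈) = ∈-map⁺ suc (∈-elements⁺ p x∈)

∈-elements⁻ : ∀ {n} (p : Subset n) {x} → x ∈ₗ elements p → x ∈ p
∈-elements⁻ (inside ∷ p) (here refl) = here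
∈-elements⁻ (inside ∷ p) (there x∈) with ∈-map⁻ suc x∈
... | y , y∈ , refl = there (∈-elements⁻ p y∈)
∈-elements⁻ (outside ∷ p) x∈ with ∈-map⁻ suc x∈
... | y , y∈ , refl = there (∈-elements⁻ p y∈)

unique⊆⇒length≤ : {A : Set} {xs : List A} (ys : List A) → Unique xs → xs ⊆ₗ ys → length xs ≤ length ys
unique⊆⇒length≤ ys [] _ = z≤n
unique⊆⇒length≤ {xs = x ∷ xs} ys x∷xs!@(_ ∷ xs!) x∷xs⊆ys with ∈-∃++ (x∷xs⊆ys (here refl))
... | l , r , refl = begin
  suc (length xs)             ≤⟨ s≤s (unique⊆⇒length≤ (l ++ r) xs! xs⊆l++r) ⟩
  suc (length (l ++ r))       ≡⟨ cong suc (length-++ l) ⟩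
  suc (length l + length r)   ≡⟨ sym (ℕ.+-suc (length l) (length r)) ⟩
  length l + suc (length r)   ≡⟨ sym (length-++ l) ⟩
  length (l ++ x ∷ r)         ∎
  where
  open ℕ.≤-Reasoning
  xs⊆l++r : xs ⊆ₗ (l ++ r)
  xs⊆l++r z∈ with ∈-++⁻ l (x∷xs⊆ys (there z∈))
  ... | inj₁ z∈l         = ∈-++⁺ˡ z∈l
  ... | inj₂ (here refl) = contradiction z∈ (Unique[x∷xs]⇒x∉xs x∷xs!)
  ... | inj₂ (there z∈r) = ∈-++⁺ʳ l z∈r

length≤∣∣ : ∀ {n} (p : Subset n) {xs : List (Fin n)} → Unique xs → (∀ {x} → x ∈ₗ xs → x ∈ p) →
            length xs ≤ ∣ p ∣
length≤∣∣ p xs! xs⊆p =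
  subst (_ ≤_) (elements-length p) (unique⊆⇒length≤ (elements p) xs! (∈-elements⁺ p ∘ xs⊆p))

∣∣≤length : ∀ {n} (p : Subset n) (ys : List (Fin n)) → (∀ {x} → x ∈ p → x ∈ₗ ys) → ∣ p ∣ ≤ length ys
∣∣≤length p ys p⊆ys =
  subst (_≤ _) (elements-length p) (unique⊆⇒length≤ ys (elements-unique p) (p⊆ys ∘ ∈-elements⁻ p))

∉⇒∣∣<n : ∀ {n} {p : Subset n} {x} → x ∉ p → ∣ p ∣ < n
∉⇒∣∣<n {n} {p} {x} x∉p = subst (∣ p ∣ <_) (∣⊤∣≡n n) (p⊂q⇒∣p∣<∣q∣ (⊆⊤ , x , ∈⊤ , x∉p))

2^k≤n⇒k≤⌈log₂n⌉ : ∀ {k n} → 2 ^ k ≤ n → k ≤ ⌈log₂ n ⌉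
2^k≤n⇒k≤⌈log₂n⌉ {k} 2^k≤n = subst (_≤ _) (⌈log₂2^n⌉≡n k) (⌈log₂⌉-mono-≤ 2^k≤n)

two-members : ∀ {n} (p : Subset n) → 2 ≤ ∣ p ∣ → ∃₂ λ s t → s ≢ t × s ∈ p × t ∈ p
two-members p 2≤∣p∣ =
  pick (elements p) (elements-unique p) (subst (2 ≤_) (sym (elements-length p)) 2≤∣p∣) (∈-elements⁻ p)
  where
  pick : (xs : List _) → Unique xs → 2 ≤ length xs → (∀ {x} → x ∈ₗ xs → x ∈ p) →
         ∃₂ λ s t → s ≢ t × s ∈ p × t ∈ p
  pick (s ∷ t ∷ _) ((s≢t ∷ _) ∷ _) _ xs⊆p = s , t , s≢t , xs⊆p (here refl) , xs⊆p (there (here refl))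
  pick (_ ∷ []) _ (s≤s ()) _

does⇒witness : ∀ {A : Set} (a? : Dec A) → does a? ≡ true → A
does⇒witness (yes a) _ = a

subsetOf : ∀ {n} {P : Fin n → Set} → Decidable P → Subset n
subsetOf P? = tabulate (does ∘ P?)

∈-subsetOf⁺ : ∀ {n} {P : Fin n → Set} (P? : Decidable P) {x} → P x → x ∈ subsetOf P?
∈-subsetOf⁺ P? {x} Px = lookup⇒[]= x _ (trans (lookup∘tabulate _ x) (dec-true (P? x) Px))

∈-subsetOf⁻ : ∀ {n} {P : Fin n → Set} (P? : Decidable P) {x} → x ∈ subsetOf P? → P x
∈-subsetOf⁻ P? {x} x∈ = does⇒witness (P? x) (trans (sym (lookup∘tabulate _ x)) ([]=⇒lookup x∈))

module SteinerTripleSystem {v b : ℕ} (B : Fin b → Subset v) (sts : IsSTS v b B) where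

  Point : Set
  Point = Fin v

  block-size : ∀ i → ∣ B i ∣ ≡ 3
  block-size = proj₁ sts

  line : {x y : Point} → x ≢ y → Fin b
  line x≢y = proj₁ (proj₂ (proj₂ sts) _ _ x≢y)

  line-x : ∀ {x y} (x≢y : x ≢ y) → x ∈ B (line x≢y)
  line-x x≢y = proj₁ (proj₁ (proj₂ (proj₂ (proj₂ sts) _ _ x≢y)))

  line-y : ∀ {x y} (x≢y : x ≢ y) → y ∈ B (line x≢y)
  line-y x≢y = proj₂ (proj₁ (proj₂ (proj₂ (proj₂ sts) _ _ x≢y)))

  same-block : ∀ {x y i j} → x ≢ y → x ∈ B i → y ∈ B i → x ∈ B j → y ∈ B j → i ≡ j
  same-block {x} {y} x≢y xi yi xj yj = trans (unique xi yi) (sym (unique xj yj))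
    where
    unique : ∀ {k} → x ∈ B k → y ∈ B k → k ≡ line x≢y
    unique = proj₂ (proj₂ (proj₂ (proj₂ sts) _ _ x≢y)) _

  every-block-has-two-points : ∀ i → ∃₂ λ s t → s ≢ t × s ∈ B i × t ∈ B i
  every-block-has-two-points i = two-members (B i) (subst (2 ≤_) (sym (block-size i)) (s≤s (s≤s z≤n)))

  at-most-three : ∀ {i x y u w} → x ≢ y → u ≢ x → u ≢ y → w ≢ x → w ≢ y →
                  x ∈ B i → y ∈ B i → u ∈ B i → w ∈ B i → u ≡ w
  at-most-three {i} {x} {y} {u} {w} x≢y u≢x u≢y w≢x w≢y xi yi ui wi with u ≟ w
  ... | yes u≡w = u≡w
  ... | no  u≢w = contradiction (subst (4 ≤_) (block-size i) (length≤∣∣ (B i) distinct members)) ℕ.1+n≰n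
    where
    distinct : Unique (x ∷ y ∷ u ∷ w ∷ [])
    distinct = (x≢y ∷ ≢-sym u≢x ∷ ≢-sym w≢x ∷ []) ∷ (≢-sym u≢y ∷ ≢-sym w≢y ∷ []) ∷ (u≢w ∷ []) ∷ [] ∷ []
    members : ∀ {z} → z ∈ₗ x ∷ y ∷ u ∷ w ∷ [] → z ∈ B i
    members (here refl)                         = xi
    members (there (here refl))                 = yi
    members (there (there (here refl)))         = ui
    members (there (there (there (here refl)))) = wi

  third-exists : ∀ {x y} (x≢y : x ≢ y) → ∃ λ u → u ∈ B (line x≢y) × u ≢ x × u ≢ y
  third-exists {x} {y} x≢y with any? (λ u → u ∈? B (line x≢y) ×-dec ¬? (u ≟ x) ×-dec ¬? (u ≟ y))
  ... | yes found = found
  ... | no  none  =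
    contradiction (subst (_≤ 2) (block-size (line x≢y)) (∣∣≤length (B (line x≢y)) (x ∷ y ∷ []) x-or-y)) ℕ.1+n≰n
    where
    x-or-y : ∀ {z} → z ∈ B (line x≢y) → z ∈ₗ x ∷ y ∷ []
    x-or-y {z} zi with z ≟ x | z ≟ y
    ... | yes z≡x | _       = here z≡x
    ... | no  _   | yes z≡y = there (here z≡y)
    ... | no  z≢x | no  z≢y = contradiction (z , zi , z≢x , z≢y) none

  -- third x y is the third point of the block through x and y (and x when x = y).
  third : Point → Point → Point
  third x y with x ≟ y
  ... | yes _   = x
  ... | no  x≢y = proj₁ (third-exists x≢y)

  third-self : ∀ x → third x x ≡ x
  third-self x with x ≟ x
  ... | yes _   = refl
  ... | no  x≢x = contradiction refl x≢x

  third-on-block : ∀ {x y i} → x ≢ y → x ∈ B i → y ∈ B i → third x y ∈ B i × third x y ≢ x × third x y ≢ y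
  third-on-block {x} {y} x≢y xi yi with x ≟ y
  ... | yes x≡y  = contradiction x≡y x≢y
  ... | no  x≢y′ with third-exists x≢y′
  ...   | u , u∈line , u≢x , u≢y =
    subst (λ j → u ∈ B j) (same-block x≢y′ (line-x x≢y′) (line-y x≢y′) xi yi) u∈line , u≢x , u≢y

  third-on-line : ∀ {x y} (x≢y : x ≢ y) → third x y ∈ B (line x≢y)
  third-on-line x≢y = proj₁ (third-on-block x≢y (line-x x≢y) (line-y x≢y))

  third-unique : ∀ {x y z i} → x ≢ y → x ∈ B i → y ∈ B i → z ∈ B i → z ≢ x → z ≢ y → z ≡ third x y
  third-unique x≢y xi yi zi z≢x z≢y with third-on-block x≢y xi yi
  ... | ti , t≢x , t≢y = at-most-three x≢y z≢x z≢y t≢x t≢y xi yi zi ti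

  block-points : ∀ {s t y} (s≢t : s ≢ t) → y ∈ B (line s≢t) → y ≡ s ⊎ y ≡ t ⊎ y ≡ third s t
  block-points {s} {t} {y} s≢t yi with y ≟ s | y ≟ t
  ... | yes y≡s | _       = inj₁ y≡s
  ... | no  _   | yes y≡t = inj₂ (inj₁ y≡t)
  ... | no  y≢s | no  y≢t = inj₂ (inj₂ (third-unique s≢t (line-x s≢t) (line-y s≢t) yi y≢s y≢t))

  -- With w ≠ p and u = third p w, the three points p, w, u form a block,
  -- so each of them is the third point of the other two.
  third-involutive : ∀ p w → third p (third p w) ≡ w
  third-involutive p w = by-cases (p ≟ w)
    where
    by-cases : Dec (p ≡ w) → third p (third p w) ≡ w
    by-cases (yes p≡w) = subst (λ z → third p (third p z) ≡ z) p≡w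
                           (trans (cong (third p) (third-self p)) (third-self p))
    by-cases (no p≢w) with third-on-block p≢w (line-x p≢w) (line-y p≢w)
    ... | ui , u≢p , u≢w =
      sym (third-unique (≢-sym u≢p) (line-x p≢w) ui (line-y p≢w) (≢-sym p≢w) (≢-sym u≢w))

  third-swap : ∀ {p w} → p ≢ w → third w (third p w) ≡ p
  third-swap p≢w with third-on-block p≢w (line-x p≢w) (line-y p≢w)
  ... | ui , u≢p , u≢w = sym (third-unique (≢-sym u≢w) (line-y p≢w) ui (line-x p≢w) p≢w (≢-sym u≢p))

  third-injective : ∀ p {w w′} → third p w ≡ third p w′ → w ≡ w′
  third-injective p {w} {w′} eq = begin
    w                     ≡⟨ sym (third-involutive p w) ⟩
    third p (third p w)   ≡⟨ cong (third p) eq ⟩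
    third p (third p w′)  ≡⟨ third-involutive p w′ ⟩
    w′                    ∎
    where open ≡-Reasoning

module Closure {v b : ℕ} (B : Fin b → Subset v) (sts : IsSTS v b B) where
  open SteinerTripleSystem B sts

  Closed : Subset v → Set
  Closed C = ∀ {s t} → s ∈ C → t ∈ C → s ≢ t → third s t ∈ C

  Spanned : Subset v → Point → Set
  Spanned C y = ∃ λ s → ∃ λ t → s ∈ C × t ∈ C × s ≢ t × third s t ≡ y

  spanned? : ∀ C → Decidable (Spanned C)
  spanned? C y = any? λ s → any? λ t → s ∈? C ×-dec t ∈? C ×-dec ¬? (s ≟ t) ×-dec third s t ≟ y

  step : Subset v → Subset v
  step C = C ∪ subsetOf (spanned? C)

  step-⊇ : ∀ C → C ⊆ step C
  step-⊇ C = p⊆p∪q _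

  step-spans : ∀ {C s t} → s ∈ C → t ∈ C → s ≢ t → third s t ∈ step C
  step-spans {C} {s} {t} s∈ t∈ s≢t = q⊆p∪q C _ (∈-subsetOf⁺ (spanned? C) (s , t , s∈ , t∈ , s≢t , refl))

  step-cases : ∀ {C y} → y ∈ step C → y ∈ C ⊎ Spanned C y
  step-cases {C} y∈ with x∈p∪q⁻ C _ y∈
  ... | inj₁ y∈C       = inj₁ y∈C
  ... | inj₂ y∈spanned = inj₂ (∈-subsetOf⁻ (spanned? C) y∈spanned)

  step-mono : ∀ {C D} → C ⊆ D → step C ⊆ step D
  step-mono {D = D} C⊆D y∈ with step-cases y∈
  ... | inj₁ y∈C                            = step-⊇ D (C⊆D y∈C)
  ... | inj₂ (s , t , s∈ , t∈ , s≢t , refl) = step-spans (C⊆D s∈) (C⊆D t∈) s≢t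

  fixed⇒closed : ∀ {C} → step C ⊆ C → Closed (step C)
  fixed⇒closed step⊆C s∈ t∈ s≢t = step-spans (step⊆C s∈) (step⊆C t∈) s≢t

  closed⇒fixed : ∀ {C} → Closed C → step C ⊆ C
  closed⇒fixed closed y∈ with step-cases y∈
  ... | inj₁ y∈C                            = y∈C
  ... | inj₂ (s , t , s∈ , t∈ , s≢t , refl) = closed s∈ t∈ s≢t

  not-growing⇒fixed : ∀ {C} → ¬ (C ⊂ step C) → step C ⊆ C
  not-growing⇒fixed {C} C⊄step {y} y∈ with y ∈? C
  ... | yes y∈C = y∈C
  ... | no  y∉C = ⊥-elim (C⊄step (step-⊇ C , y , y∈ , y∉C))

  rounds : ℕ → Subset v → Subset v
  rounds zero    C = C
  rounds (suc i) C = step (rounds i C)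

  rounds-⊇ : ∀ i C → C ⊆ rounds i C
  rounds-⊇ zero    C x∈ = x∈
  rounds-⊇ (suc i) C x∈ = step-⊇ (rounds i C) (rounds-⊇ i C x∈)

  rounds-mono : ∀ i {C D} → C ⊆ D → rounds i C ⊆ rounds i D
  rounds-mono zero    C⊆D = C⊆D
  rounds-mono (suc i) C⊆D = step-mono (rounds-mono i C⊆D)

  rounds-grow : ∀ i C → Closed (rounds i C) ⊎ i ≤ ∣ rounds i C ∣
  rounds-grow zero    C = inj₂ z≤n
  rounds-grow (suc i) C with rounds-grow i C | rounds i C ⊂? step (rounds i C)
  ... | inj₁ closed | _        = inj₁ (fixed⇒closed (closed⇒fixed closed))
  ... | inj₂ i≤     | yes grow = inj₂ (ℕ.≤-trans (s≤s i≤) (p⊂q⇒∣p∣<∣q∣ grow))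
  ... | inj₂ _      | no  same = inj₁ (fixed⇒closed (not-growing⇒fixed same))

  closure : Subset v → Subset v
  closure = rounds v

  closure-closed : ∀ C → Closed (closure C)
  closure-closed C with rounds-grow v C
  ... | inj₁ closed = closed
  ... | inj₂ v≤∣C∣  = λ _ _ _ → everything
    where
    everything : ∀ {y} → y ∈ closure C
    everything {y} = subst (y ∈_) (sym (∣p∣≡n⇒p≡⊤ (ℕ.≤-antisym (∣p∣≤n (closure C)) v≤∣C∣))) ∈⊤

  third-leaves : ∀ {W p w} → Closed W → p ∉ W → w ∈ W → third p w ∉ W
  third-leaves {W} {p} {w} closed p∉W w∈W u∈W = p∉W (subst (_∈ W) (third-swap p≢w) (closed w∈W u∈W w≢u))
    where
    p≢w : p ≢ w
    p≢w p≡w = p∉W (subst (_∈ W) (sym p≡w) w∈W)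
    w≢u : w ≢ third p w
    w≢u = ≢-sym (proj₂ (proj₂ (third-on-block p≢w (line-x p≢w) (line-y p≢w))))

  -- Doubling: W, the point p and the third points of p with the points of W are
  -- pairwise distinct points of W′, hence |W′| + 1 ≥ 2 (|W| + 1).
  doubling : ∀ {W W′ p} → Closed W → Closed W′ → W ⊆ W′ → p ∉ W → p ∈ W′ → 2 * suc ∣ W ∣ ≤ suc ∣ W′ ∣
  doubling {W} {W′} {p} closedW closedW′ W⊆W′ p∉W p∈W′ =
    subst (_≤ suc ∣ W′ ∣) (cong suc size) (s≤s (length≤∣∣ W′ distinct members))
    where
    ws = elements W
    ts = map (third p) ws

    p≢ : ∀ {w} → w ∈ₗ ws → p ≢ w
    p≢ w∈ws p≡w = p∉W (subst (_∈ W) (sym p≡w) (∈-elements⁻ W w∈ws))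

    p≢ts : All.All (p ≢_) ts
    p≢ts = All-map⁺ (All.tabulate λ w∈ws →
             ≢-sym (proj₁ (proj₂ (third-on-block (p≢ w∈ws) (line-x (p≢ w∈ws)) (line-y (p≢ w∈ws))))))

    disjoint : Disjoint ws (p ∷ ts)
    disjoint (z∈ws , here refl)   = p∉W (∈-elements⁻ W z∈ws)
    disjoint (z∈ws , there z∈ts) with ∈-map⁻ (third p) z∈ts
    ... | w , w∈ws , refl = third-leaves closedW p∉W (∈-elements⁻ W w∈ws) (∈-elements⁻ W z∈ws)

    distinct : Unique (ws ++ p ∷ ts)
    distinct = ++⁺ (elements-unique W) (p≢ts ∷ Unique-map⁺ (third-injective p) (elements-unique W)) disjoint

    members : ∀ {z} → z ∈ₗ ws ++ p ∷ ts → z ∈ W′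
    members z∈ with ∈-++⁻ ws z∈
    ... | inj₁ z∈ws          = W⊆W′ (∈-elements⁻ W z∈ws)
    ... | inj₂ (here refl)   = p∈W′
    ... | inj₂ (there z∈ts)  with ∈-map⁻ (third p) z∈ts
    ...   | w , w∈ws , refl = closedW′ p∈W′ (W⊆W′ (∈-elements⁻ W w∈ws)) (p≢ w∈ws)

    size : length (ws ++ p ∷ ts) ≡ ∣ W ∣ + suc (∣ W ∣ + 0)
    size = begin
      length (ws ++ p ∷ ts)          ≡⟨ length-++ ws ⟩
      length ws + suc (length ts)    ≡⟨ cong (λ n → length ws + suc n) (length-map (third p) ws) ⟩
      length ws + suc (length ws)    ≡⟨ cong (λ n → n + suc n) (elements-length W) ⟩
      ∣ W ∣ + suc ∣ W ∣              ≡⟨ cong (λ n → ∣ W ∣ + suc n) (sym (ℕ.+-identityʳ ∣ W ∣)) ⟩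
      ∣ W ∣ + suc (∣ W ∣ + 0)        ∎
      where open ≡-Reasoning

  Generates : Subset v → Set
  Generates A = ∀ y → y ∈ closure A

  generates-or-misses : ∀ A → Generates A ⊎ ∃ λ p → p ∉ closure A
  generates-or-misses A with all? (_∈? closure A)
  ... | yes generates = inj₁ generates
  ... | no  misses    = inj₂ (¬∀⟶∃¬ v _ (_∈? closure A) misses)

  adjoin-size : ∀ (p : Point) A → ∣ ⁅ p ⁆ ∪ A ∣ ≤ suc ∣ A ∣
  adjoin-size p A =
    subst (∣ ⁅ p ⁆ ∪ A ∣ ≤_) (cong suc (elements-length A)) (∣∣≤length (⁅ p ⁆ ∪ A) (p ∷ elements A) covered)
    where
    covered : ∀ {x} → x ∈ ⁅ p ⁆ ∪ A → x ∈ₗ p ∷ elements A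
    covered x∈ with x∈p∪q⁻ ⁅ p ⁆ A x∈
    ... | inj₁ x∈⁅p⁆ = here (x∈⁅y⁆⇒x≡y p x∈⁅p⁆)
    ... | inj₂ x∈A   = there (∈-elements⁺ A x∈A)

  adjoin-doubles : ∀ {A p} → p ∉ closure A → 2 * suc ∣ closure A ∣ ≤ suc ∣ closure (⁅ p ⁆ ∪ A) ∣
  adjoin-doubles {A} {p} p∉ =
    doubling (closure-closed A) (closure-closed (⁅ p ⁆ ∪ A)) (rounds-mono v (q⊆p∪q ⁅ p ⁆ A)) p∉
             (rounds-⊇ v (⁅ p ⁆ ∪ A) (p⊆p∪q A (x∈⁅x⁆ p)))

  greedy : Point → ∀ m → ∃ λ A → ∣ A ∣ ≤ suc m × (Generates A ⊎ 2 ^ suc m ≤ suc ∣ closure A ∣)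
  greedy x₀ zero =
    ⁅ x₀ ⁆ , ℕ.≤-reflexive (∣⁅x⁆∣≡1 x₀) ,
    inj₂ (s≤s (subst (_≤ ∣ closure ⁅ x₀ ⁆ ∣) (∣⁅x⁆∣≡1 x₀) (p⊆q⇒∣p∣≤∣q∣ (rounds-⊇ v ⁅ x₀ ⁆))))
  greedy x₀ (suc m) with greedy x₀ m
  ... | A , size , inj₁ generates = A , ℕ.m≤n⇒m≤1+n size , inj₁ generates
  ... | A , size , inj₂ bound with generates-or-misses A
  ...   | inj₁ generates = A , ℕ.m≤n⇒m≤1+n size , inj₁ generates
  ...   | inj₂ (p , p∉)  =
    ⁅ p ⁆ ∪ A , ℕ.≤-trans (adjoin-size p A) (s≤s size) ,
    inj₂ (ℕ.≤-trans (ℕ.*-monoʳ-≤ 2 bound) (adjoin-doubles {A} p∉))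

  small-generating-set : Point → ∃ λ A → ∣ A ∣ ≤ 1 + ⌈log₂ v ⌉ × Generates A
  small-generating-set x₀ with greedy x₀ ⌈log₂ v ⌉
  ... | A , size , inj₁ generates = A , size , generates
  ... | A , size , inj₂ bound with generates-or-misses A
  ...   | inj₁ generates = A , size , generates
  ...   | inj₂ (p , p∉)  = contradiction (2^k≤n⇒k≤⌈log₂n⌉ (ℕ.≤-trans bound (∉⇒∣∣<n {p = closure A} p∉))) ℕ.1+n≰n

module WeisfeilerLeman {X : Set} (_≟X_ : DecidableEquality X) (adj : X → X → Bool) (ind : X → Bool)
                       (loopless : ∀ x → adj x x ≡ false) where
  open WL _≟X_ adj ind

  diagonal? : Colour X → Bool
  diagonal? vertex    = true
  diagonal? (indiv _) = true
  diagonal? edge      = false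
  diagonal? nonedge   = false

  c₀-diagonal : ∀ x → diagonal? (c₀ x x) ≡ true
  c₀-diagonal x with x ≟X x
  ... | no  x≢x = contradiction refl x≢x
  ... | yes _   with ind x
  ...   | true  = refl
  ...   | false = refl

  c₀-off-diagonal : ∀ {x y} → x ≢ y → diagonal? (c₀ x y) ≡ false
  c₀-off-diagonal {x} {y} x≢y with x ≟X y
  ... | yes x≡y = contradiction x≡y x≢y
  ... | no  _   with adj x y
  ...   | true  = refl
  ...   | false = refl

  diagonal-partner : ∀ {x y y′} → c₀ x x ≡ c₀ y y′ → y ≡ y′
  diagonal-partner {x} {y} {y′} eq = decide (y ≟X y′)
    where
    decide : Dec (y ≡ y′) → y ≡ y′
    decide (yes y≡y′) = y≡y′
    decide (no  y≢y′) =
      contradiction (trans (sym (c₀-diagonal x)) (trans (cong diagonal? eq) (c₀-off-diagonal y≢y′))) λ ()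

  adj⇒c₀-edge : ∀ {x y} → adj x y ≡ true → c₀ x y ≡ edge
  adj⇒c₀-edge {x} {y} xy with x ≟X y
  ... | yes refl = contradiction (trans (sym xy) (loopless x)) λ ()
  ... | no  _    rewrite xy = refl

  c₀-edge⇒adj : ∀ {x y} → c₀ x y ≡ edge → adj x y ≡ true
  c₀-edge⇒adj {x} {y} eq with x ≟X y
  ... | yes _ with ind x
  c₀-edge⇒adj () | yes _ | true
  c₀-edge⇒adj () | yes _ | false
  c₀-edge⇒adj {x} {y} eq | no _ with adj x y
  ...   | true  = refl
  c₀-edge⇒adj () | no _ | false

  c₀-individualized : ∀ {x} → ind x ≡ true → c₀ x x ≡ indiv x
  c₀-individualized {x} ix with x ≟X x
  ... | no  x≢x = contradiction refl x≢x
  ... | yes _   rewrite ix = refl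

  c₀≡indiv : ∀ {x y} → c₀ y y ≡ indiv x → y ≡ x
  c₀≡indiv {x} {y} eq with y ≟X y
  ... | no  y≢y = contradiction refl y≢y
  ... | yes _   with ind y
  c₀≡indiv refl | yes _ | true  = refl
  c₀≡indiv ()   | yes _ | false

  Same⇒c₀ : ∀ d {x y x′ y′} → Same d x y x′ y′ → c₀ x y ≡ c₀ x′ y′
  Same⇒c₀ zero    same = same
  Same⇒c₀ (suc d) same = Same⇒c₀ d (proj₁ same)

  Same-weaken : ∀ k d {x y x′ y′} → Same (k + d) x y x′ y′ → Same d x y x′ y′
  Same-weaken zero    d same = same
  Same-weaken (suc k) d same = Same-weaken k d (proj₁ same)

  Same-sym : ∀ d {x y x′ y′} → Same d x y x′ y′ → Same d x′ y′ x y
  Same-sym zero    same = sym same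
  Same-sym (suc d) {x} {y} {x′} {y′} (same , σ , matched) = Same-sym d same , ↔-sym σ , matched⁻¹
    where
    matched⁻¹ : ∀ z′ → Same d x′ z′ x (Inverse.from σ z′) × Same d z′ y′ (Inverse.from σ z′) y
    matched⁻¹ z′ with matched (Inverse.from σ z′)
    ... | sameˡ , sameʳ rewrite Inverse.strictlyInverseˡ σ z′ = Same-sym d sameˡ , Same-sym d sameʳ

  Same-target : ∀ d {x y x′ y′} → Same (suc d) x y x′ y′ → Same d y y y′ y′
  Same-target d {y = y} {y′ = y′} (_ , σ , matched) =
    subst (λ w → Same d y y w y′) (diagonal-partner (Same⇒c₀ d sameʳ)) sameʳ
    where
    sameʳ : Same d y y (Inverse.to σ y) y′
    sameʳ = proj₂ (matched y)

  Distinguished : ℕ → X → Set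
  Distinguished d x = ∀ y → Same d x x y y → x ≡ y

  Distinguished-mono : ∀ {d e x} → d ≤ e → Distinguished d x → Distinguished e x
  Distinguished-mono {d} {e} {x} d≤e distinguished y same =
    distinguished y (Same-weaken (e ∸ d) d (subst (λ n → Same n x x y y) (sym (ℕ.m∸n+n≡m d≤e)) same))

  individualized-distinguished : ∀ {x} → ind x ≡ true → Distinguished 0 x
  individualized-distinguished ix y same = sym (c₀≡indiv (trans (sym same) (c₀-individualized ix)))

  distinguished-unique : ∀ {d e x q} → d ≤ e → Distinguished d q → Same e x x q q → x ≡ q
  distinguished-unique {d} {e} d≤e q-dist same = sym (Distinguished-mono d≤e q-dist _ (Same-sym e same))

  distinguished-neighbour : ∀ d {x x′ z} → Same (2 + d) x x x′ x′ → adj x z ≡ true →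
                            Distinguished d z → adj x′ z ≡ true
  distinguished-neighbour d {x} {x′} {z} (_ , σ , matched) xz distinguished =
    subst (λ w → adj x′ w ≡ true) (sym (distinguished (Inverse.to σ z) (Same-target d sameˡ)))
          (c₀-edge⇒adj (trans (sym (Same⇒c₀ (suc d) sameˡ)) (adj⇒c₀-edge xz)))
    where
    sameˡ : Same (suc d) x z x′ (Inverse.to σ z)
    sameˡ = proj₁ (matched z)

module IncidenceGraph {v b : ℕ} (B : Fin b → Subset v) (sts : IsSTS v b B) (S : Subset v) where
  open SteinerTripleSystem B sts
  open Closure B sts
  open WL Γ≟ (Γadj B) (Γind S) using (Same)

  Γ-loopless : ∀ x → Γadj B x x ≡ false
  Γ-loopless (inj₁ _) = refl
  Γ-loopless (inj₂ _) = refl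

  open WeisfeilerLeman Γ≟ (Γadj B) (Γind S) Γ-loopless

  incidentᵖᵇ : ∀ {x i} → x ∈ B i → Γadj B (inj₁ x) (inj₂ i) ≡ true
  incidentᵖᵇ {x} {i} x∈ = dec-true (x ∈? B i) x∈

  incidentᵇᵖ : ∀ {x i} → x ∈ B i → Γadj B (inj₂ i) (inj₁ x) ≡ true
  incidentᵇᵖ {x} {i} x∈ = dec-true (x ∈? B i) x∈

  point-neighbour : ∀ q {x} → Γadj B q (inj₁ x) ≡ true → ∃ λ i → q ≡ inj₂ i × x ∈ B i
  point-neighbour (inj₂ i) {x} qx = i , refl , does⇒witness (x ∈? B i) qx

  block-neighbour : ∀ q {i} → Γadj B q (inj₂ i) ≡ true → ∃ λ x → q ≡ inj₁ x × x ∈ B i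
  block-neighbour (inj₁ x) {i} qi = x , refl , does⇒witness (x ∈? B i) qi

  block-distinguished : ∀ d {s t i} → s ≢ t → s ∈ B i → t ∈ B i →
                        Distinguished d (inj₁ s) → Distinguished d (inj₁ t) → Distinguished (2 + d) (inj₂ i)
  block-distinguished d s≢t si ti s-dist t-dist q same
    with point-neighbour q (distinguished-neighbour d same (incidentᵇᵖ si) s-dist)
       | point-neighbour q (distinguished-neighbour d same (incidentᵇᵖ ti) t-dist)
  ... | j , refl , sj | _ , refl , tj = cong inj₂ (same-block s≢t si ti sj tj)

  -- Hence the third point u of two distinguished points s, t is distinguished four
  -- rounds later: a vertex coloured like u is adjacent to their distinguished block,
  -- so it is s, t or u, and it cannot be the distinguished s or t.
  third-distinguished : ∀ d {s t} → s ≢ t → Distinguished d (inj₁ s) → Distinguished d (inj₁ t) →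
                        Distinguished (4 + d) (inj₁ (third s t))
  third-distinguished d {s} {t} s≢t s-dist t-dist q same =
    [ excluded s-dist , [ excluded t-dist , sym ]′ ]′ located
    where
    excluded : ∀ {r} → Distinguished d r → q ≡ r → inj₁ (third s t) ≡ q
    excluded r-dist q≡r = distinguished-unique (ℕ.m≤n+m d 4) (subst (Distinguished d) (sym q≡r) r-dist) same

    located : q ≡ inj₁ s ⊎ q ≡ inj₁ t ⊎ q ≡ inj₁ (third s t)
    located with block-neighbour q (distinguished-neighbour (2 + d) same (incidentᵖᵇ (third-on-line s≢t))
                   (block-distinguished d s≢t (line-x s≢t) (line-y s≢t) s-dist t-dist))
    ... | y , q≡y , yi = Sum.map at (Sum.map at at) (block-points s≢t yi)
      where
      at : ∀ {z} → y ≡ z → q ≡ inj₁ z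
      at y≡z = trans q≡y (cong inj₁ y≡z)

  closure-distinguished : ∀ i {y} → y ∈ rounds i S → Distinguished (i * 4) (inj₁ y)
  closure-distinguished zero    {y} y∈S = individualized-distinguished (dec-true (y ∈? S) y∈S)
  closure-distinguished (suc i) y∈ = [ earlier , spanned ]′ (step-cases y∈)
    where
    earlier : ∀ {y} → y ∈ rounds i S → Distinguished (suc i * 4) (inj₁ y)
    earlier y∈ = Distinguished-mono (ℕ.m≤n+m (i * 4) 4) (closure-distinguished i y∈)

    spanned : ∀ {y} → Spanned (rounds i S) y → Distinguished (suc i * 4) (inj₁ y)
    spanned (s , t , s∈ , t∈ , s≢t , third≡y) =
      subst (Distinguished (suc i * 4) ∘ inj₁) third≡y
            (third-distinguished (i * 4) s≢t (closure-distinguished i s∈) (closure-distinguished i t∈))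

  generating⇒distinguished : Generates S → ∀ p → Distinguished (2 + v * 4) p
  generating⇒distinguished generates (inj₁ y) =
    Distinguished-mono (ℕ.m≤n+m (v * 4) 2) (closure-distinguished v (generates y))
  generating⇒distinguished generates (inj₂ i) with every-block-has-two-points i
  ... | s , t , s≢t , si , ti =
    block-distinguished (v * 4) s≢t si ti
      (closure-distinguished v (generates s)) (closure-distinguished v (generates t))

  generating⇒splits : Generates S → 2 + v * 4 ≤ (v + b) ^ 2 → CompletelySplits B S
  generating⇒splits generates 4v+2≤N p = Distinguished-mono 4v+2≤N (generating⇒distinguished generates p)

depth-bound : ∀ {v b} → 4 ≤ v → 1 ≤ b → 2 + v * 4 ≤ (v + b) ^ 2
depth-bound {v} {b} 4≤v 1≤b = begin
  2 + v * 4          ≤⟨ ℕ.+-monoˡ-≤ (v * 4) {2} {4} (s≤s (s≤s z≤n)) ⟩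
  suc v * 4          ≤⟨ ℕ.*-mono-≤ 1+v≤v+b (ℕ.≤-trans 4≤v (ℕ.m≤m+n v b)) ⟩
  (v + b) * (v + b)  ≡⟨ cong ((v + b) *_) (sym (ℕ.*-identityʳ (v + b))) ⟩
  (v + b) ^ 2        ∎
  where
  open ℕ.≤-Reasoning
  1+v≤v+b : suc v ≤ v + b
  1+v≤v+b = subst (_≤ v + b) (ℕ.+-comm v 1) (ℕ.+-monoʳ-≤ v 1≤b)

-- The greedy generating set (started at a point x₀) completely splits Γ; the
-- block i₀ only witnesses b ≥ 1.
greedy-set-splits : ∀ {v b} (B : Fin b → Subset v) → IsSTS v b B → 4 ≤ v → Fin v → Fin b →
                    Σ (Subset v) λ S → (∣ S ∣ ≤ 1 + ⌈log₂ v ⌉) × CompletelySplits B S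
greedy-set-splits B sts 4≤v x₀ i₀ with Closure.small-generating-set B sts x₀
... | S , size , generates =
  S , size , IncidenceGraph.generating⇒splits B sts S generates (depth-bound 4≤v (ℕ.≤-trans (s≤s z≤n) (toℕ<n i₀)))

-- Proposition 3.2.  A system with v > 3 has the points 0 ≠ 1 and hence the block through them.
proposition3p2 : (v b : ℕ) (B : Fin b → Subset v) → 3 < v → IsSTS v b B →
    Σ (Subset v) λ S → (∣ S ∣ ≤ 1 + ⌈log₂ v ⌉) × CompletelySplits B S
proposition3p2 zero          b B ()       sts
proposition3p2 (suc zero)    b B (s≤s ()) sts
proposition3p2 (suc (suc w)) b B 3<v      sts =
  greedy-set-splits B sts 3<v zero (SteinerTripleSystem.line B sts {zero} {suc zero} λ ())
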